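{- (Strong normalization.) If $\Gamma;\Delta\vdash t:\rho$, then $t$ is strongly normalizing, i.e. there is a bound on the length of all reduction sequences $t\to t_1\to t_2\to\cdots$ starting at $t$.
   Context: Calculus $\lambda^{::}_{\mathtt{catch}}$. Types: $\sigma,\tau,\rho ::= \mathtt{unit} \mid \mathtt{list}\,\tau \mid \sigma\to\tau$. A type is arrow-free if it contains no $\to$; $\psi$ ranges over arrow-free types. Terms: $t,r,s ::= x \mid () \mid \mathtt{nil} \mid (::) \mid \mathtt{lrec} \mid \lambda x.r \mid t\,s \mid \mathtt{catch}\,\alpha\,t \mid \mathtt{throw}\,\alpha\,t$ ($x$ variables, $\alpha,\beta$ continuation variables; $\lambda x$ binds $x$, $\mathtt{catch}\,\alpha$ binds $\alpha$; application left-associative; $t::r$ abbreviates $(::)\,t\,r$). $\mathrm{FCV}$ = free continuation variables, $t[x:=r]$ capture-avoiding substitution. Values: $v,w ::= x \mid () \mid \mathtt{nil} \mid (::) \mid (::)\,v \mid (::)\,v\,w \mid \mathtt{lrec} \mid \mathtt{lrec}\,v \mid \mathtt{lrec}\,v\,w \mid \lambda x.r$. Contexts $E ::= \Box\,t \mid v\,\Box \mid \mathtt{throw}\,\alpha\,\Box$. Reduction $\to$ is the compatible closure of: $(\lambda x.t)\,v\to t[x:=v]$; $E[\mathtt{throw}\,\alpha\,t]\to\mathtt{throw}\,\alpha\,t$; $\mathtt{catch}\,\alpha\,(\mathtt{throw}\,\alpha\,t)\to\mathtt{catch}\,\alpha\,t$; $\mathtt{catch}\,\alpha\,(\mathtt{throw}\,\beta\,v)\to\mathtt{throw}\,\beta\,v$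 if $\alpha\notin\{\beta\}\cup\mathrm{FCV}(v)$; $\mathtt{catch}\,\alpha\,v\to v$ if $\alpha\notin\mathrm{FCV}(v)$; $\mathtt{lrec}\,v_r\,v_s\,\mathtt{nil}\to v_r$; $\mathtt{lrec}\,v_r\,v_s\,(v_h::v_t)\to v_s\,v_h\,v_t\,(\mathtt{lrec}\,v_r\,v_s\,v_t)$. Typing $\Gamma;\Delta\vdash t:\rho$ ($\Gamma$ maps variables to types, $\Delta$ maps continuation variables to arrow-free types): $x:\rho$ if $x:\rho\in\Gamma$; $():\mathtt{unit}$; $\mathtt{nil}:\mathtt{list}\,\sigma$; $(::):\sigma\to\mathtt{list}\,\sigma\to\mathtt{list}\,\sigma$; $\mathtt{lrec}:\rho\to(\sigma\to\mathtt{list}\,\sigma\to\rho\to\rho)\to\mathtt{list}\,\sigma\to\rho$; if $\Gamma,x:\sigma;\Delta\vdash t:\tau$ then $\Gamma;\Delta\vdash\lambda x.t:\sigma\to\tau$; if $\Gamma;\Delta\vdash t:\sigma\to\tau$ and $\Gamma;\Delta\vdash s:\sigma$ then $\Gamma;\Delta\vdash ts:\tau$; if $\Gamma;\Delta,\alpha:\psi\vdash t:\psi$ then $\Gamma;\Delta\vdash\mathtt{catch}\,\alpha\,t:\psi$; if $\Gamma;\Delta\vdash t:\psi$ and $\alpha:\psi\in\Delta$ then $\Gamma;\Delta\vdash\mathtt{throw}\,\alpha\,t:\tau$ for any $\tau$. -}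

module Defs where

open import Data.Nat using (ℕ; zero; suc; _≤_)
open import Data.Fin using (Fin; zero; suc)
open import Data.Vec using (Vec; _∷_; lookup)
open import Data.Vec.Relation.Unary.All using (All)
open import Data.Product using (∃)

infixr 5 _⇒_
data Ty : Set where
  unit : Ty
  list : Ty → Ty
  _⇒_  : Ty → Ty → Ty

data ArrowFree : Ty → Set where
  unit : ArrowFree unit
  list : ∀ {τ} → ArrowFree τ → ArrowFree (list τ)

-- Well-scoped terms (de Bruijn indices).
-- Term n m : at most n free term variables, m free continuation variables.

data Term (n m : ℕ) : Set where
  var   : Fin n → Term n m
  ⟨⟩    : Term n m
  nil   : Term n m
  cons  : Term n m
  lrec  : Term n m
  lam   : Term (suc n) m → Term n m
  app   : Term n m → Term n m → Term n m
  catch : Term n (suc m) → Term n m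
  throw : Fin m → Term n m → Term n m

ext : ∀ {n n'} → (Fin n → Fin n') → Fin (suc n) → Fin (suc n')
ext ρ zero    = zero
ext ρ (suc i) = suc (ρ i)

ren : ∀ {n n' m} → (Fin n → Fin n') → Term n m → Term n' m
ren ρ (var x)     = var (ρ x)
ren ρ ⟨⟩          = ⟨⟩
ren ρ nil         = nil
ren ρ cons        = cons
ren ρ lrec        = lrec
ren ρ (lam t)     = lam (ren (ext ρ) t)
ren ρ (app t s)   = app (ren ρ t) (ren ρ s)
ren ρ (catch t)   = catch (ren ρ t)
ren ρ (throw α t) = throw α (ren ρ t)

cren : ∀ {n m m'} → (Fin m → Fin m') → Term n m → Term n m'
cren ρ (var x)     = var x
cren ρ ⟨⟩          = ⟨⟩
cren ρ nil         = nil
cren ρ cons        = cons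
cren ρ lrec        = lrec
cren ρ (lam t)     = lam (cren ρ t)
cren ρ (app t s)   = app (cren ρ t) (cren ρ s)
cren ρ (catch t)   = catch (cren (ext ρ) t)
cren ρ (throw α t) = throw (ρ α) (cren ρ t)

exts : ∀ {n n' m} → (Fin n → Term n' m) → Fin (suc n) → Term (suc n') m
exts σ zero    = var zero
exts σ (suc i) = ren suc (σ i)

subst : ∀ {n n' m} → (Fin n → Term n' m) → Term n m → Term n' m
subst σ (var x)     = σ x
subst σ ⟨⟩          = ⟨⟩
subst σ nil         = nil
subst σ cons        = cons
subst σ lrec        = lrec
subst σ (lam t)     = lam (subst (exts σ) t)
subst σ (app t s)   = app (subst σ t) (subst σ s)
subst σ (catch t)   = catch (subst (λ i → cren suc (σ i)) t)
subst σ (throw α t) = throw α (subst σ t)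

single : ∀ {n m} → Term n m → Fin (suc n) → Term n m
single v zero    = v
single v (suc i) = var i

_[0:=_] : ∀ {n m} → Term (suc n) m → Term n m → Term n m
t [0:= v ] = subst (single v) t

data Value {n m : ℕ} : Term n m → Set where
  var   : ∀ x → Value (var x)
  ⟨⟩    : Value ⟨⟩
  nil   : Value nil
  cons₀ : Value cons
  cons₁ : ∀ {v} → Value v → Value (app cons v)
  cons₂ : ∀ {v w} → Value v → Value w → Value (app (app cons v) w)
  lrec₀ : Value lrec
  lrec₁ : ∀ {v} → Value v → Value (app lrec v)
  lrec₂ : ∀ {v w} → Value v → Value w → Value (app (app lrec v) w)
  lam   : ∀ r → Value (lam r)

-- One-step reduction: compatible closure of the root rules.
-- "α ∉ FCV(v)" for the bound α = index 0 is expressed by v being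
-- of the form  cren suc v'  (v' the strengthened term).

data _↦_ {n m : ℕ} : Term n m → Term n m → Set where
  β        : ∀ {t v} → Value v → app (lam t) v ↦ (t [0:= v ])
  -- E[throw α t] → throw α t,  E ::= □ t | v □ | throw α □
  throwₗ   : ∀ {α t s} → app (throw α t) s ↦ throw α t
  throwᵣ   : ∀ {v α t} → Value v → app v (throw α t) ↦ throw α t
  throwₜ   : ∀ {β α t} → throw β (throw α t) ↦ throw α t
  catch-throw-same : ∀ {t : Term n (suc m)} → catch (throw zero t) ↦ catch t
  -- catch α (throw β v) → throw β v   if α ∉ {β} ∪ FCV(v)
  catch-throw-other : ∀ {β : Fin m} {v : Term n m} → Value v →
    catch (throw (suc β) (cren suc v)) ↦ throw β v
  catch-val : ∀ {v : Term n m} → Value v → catch (cren suc v) ↦ v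
  lrec-nil : ∀ {vr vs} → Value vr → Value vs →
    app (app (app lrec vr) vs) nil ↦ vr
  lrec-cons : ∀ {vr vs vh vt} → Value vr → Value vs → Value vh → Value vt →
    app (app (app lrec vr) vs) (app (app cons vh) vt)
      ↦ app (app (app vs vh) vt) (app (app (app lrec vr) vs) vt)

data _⟶_ : ∀ {n m} → Term n m → Term n m → Set where
  root   : ∀ {n m} {t t' : Term n m} → t ↦ t' → t ⟶ t'
  ξ-lam  : ∀ {n m} {t t' : Term (suc n) m} → t ⟶ t' → lam t ⟶ lam t'
  ξ-appₗ : ∀ {n m} {t t' s : Term n m} → t ⟶ t' → app t s ⟶ app t' s
  ξ-appᵣ : ∀ {n m} {t s s' : Term n m} → s ⟶ s' → app t s ⟶ app t s'
  ξ-catch : ∀ {n m} {t t' : Term n (suc m)} → t ⟶ t' → catch t ⟶ catch t'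
  ξ-throw : ∀ {n m} {α : Fin m} {t t' : Term n m} → t ⟶ t' →
    throw α t ⟶ throw α t'

data _⟶[_]_ {n m : ℕ} : Term n m → ℕ → Term n m → Set where
  done : ∀ {t} → t ⟶[ zero ] t
  step : ∀ {t t₁ s k} → t ⟶ t₁ → t₁ ⟶[ k ] s → t ⟶[ suc k ] s

SN : ∀ {n m} → Term n m → Set
SN t = ∃ λ b → ∀ k s → t ⟶[ k ] s → k ≤ b

Ctx : ℕ → Set
Ctx n = Vec Ty n

data _⨾_⊢_∶_ {n m : ℕ} (Γ : Ctx n) (Δ : Ctx m) : Term n m → Ty → Set where
  ⊢var  : ∀ x → Γ ⨾ Δ ⊢ var x ∶ lookup Γ x
  ⊢unit : Γ ⨾ Δ ⊢ ⟨⟩ ∶ unit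
  ⊢nil  : ∀ {σ} → Γ ⨾ Δ ⊢ nil ∶ list σ
  ⊢cons : ∀ {σ} → Γ ⨾ Δ ⊢ cons ∶ (σ ⇒ list σ ⇒ list σ)
  ⊢lrec : ∀ {ρ σ} →
    Γ ⨾ Δ ⊢ lrec ∶ (ρ ⇒ (σ ⇒ list σ ⇒ ρ ⇒ ρ) ⇒ list σ ⇒ ρ)
  ⊢lam  : ∀ {σ τ t} → (σ ∷ Γ) ⨾ Δ ⊢ t ∶ τ → Γ ⨾ Δ ⊢ lam t ∶ (σ ⇒ τ)
  ⊢app  : ∀ {σ τ t s} → Γ ⨾ Δ ⊢ t ∶ (σ ⇒ τ) → Γ ⨾ Δ ⊢ s ∶ σ →
    Γ ⨾ Δ ⊢ app t s ∶ τ
  ⊢catch : ∀ {ψ t} → ArrowFree ψ → Γ ⨾ (ψ ∷ Δ) ⊢ t ∶ ψ →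
    Γ ⨾ Δ ⊢ catch t ∶ ψ
  ⊢throw : ∀ {α t τ} → Γ ⨾ Δ ⊢ t ∶ lookup Δ α →
    Γ ⨾ Δ ⊢ throw α t ∶ τ

ArrowFreeCtx : ∀ {m} → Ctx m → Set
ArrowFreeCtx Δ = All ArrowFree Δ

module Submission where

-- Tait–Girard reducibility for call-by-value with control.  Since β only fires on values, the
-- fundamental lemma substitutes reducible values, and reducibility at arrow types is Kripke
-- over renamings of continuation variables.  catch is typed only at arrow-free types, where
-- reducibility is nothing but strong normalisation, and a throw-headed strongly normalising
-- term is reducible at every type because it can only keep throwing.  Finally, reduction is
-- finitely branching, so inductive strong normalisation gives a bound on reduction lengths.

open import Defs
open import Data.Nat using (ℕ; zero; suc; _≤_; z≤n; s≤s; _⊔_)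
open import Data.Nat.Properties using (≤-trans; m≤m⊔n; m≤n⊔m)
open import Data.Fin using (Fin; zero; suc; _≟_)
open import Data.Fin.Properties using (suc-injective; any?)
open import Data.Vec using (_∷_; lookup)
open import Data.List using (List; []; _∷_; [_]; _++_; map)
open import Data.List.Relation.Unary.Any using (Any; here)
open import Data.List.Relation.Unary.Any.Properties using (++⁺ˡ; ++⁺ʳ; map⁺; gmap)
open import Data.List.Relation.Unary.All as All using (All; []; _∷_)
open import Data.Product as Product using (∃; ∃₂; _×_; _,_; proj₁; proj₂; uncurry)
open import Data.Empty using (⊥-elim)
open import Function using (_∘_; id)
open import Relation.Nullary using (Dec; yes; no; ¬_)
open import Relation.Nullary.Decidable using (map′; _×-dec_)
open import Relation.Binary.PropositionalEquality
  using (_≡_; refl; sym; trans; cong; cong₂; _≗_; module ≡-Reasoning) renaming (subst to transport)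

variable
  n n' n'' m m' m'' : ℕ

-- Renaming and substitution

ext-∘ : {ρ₁ : Fin n → Fin n'} {ρ₂ : Fin n' → Fin n''} {ρ : Fin n → Fin n''} →
  ρ₂ ∘ ρ₁ ≗ ρ → ext ρ₂ ∘ ext ρ₁ ≗ ext ρ
ext-∘ e zero    = refl
ext-∘ e (suc i) = cong suc (e i)

ext-id : {ρ : Fin n → Fin n} → ρ ≗ id → ext ρ ≗ id
ext-id e zero    = refl
ext-id e (suc i) = cong suc (e i)

cren-∘ : {θ₁ : Fin m → Fin m'} {θ₂ : Fin m' → Fin m''} {θ : Fin m → Fin m''} →
  θ₂ ∘ θ₁ ≗ θ → (t : Term n m) → cren θ₂ (cren θ₁ t) ≡ cren θ t
cren-∘ e (var x)     = refl
cren-∘ e ⟨⟩          = refl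
cren-∘ e nil         = refl
cren-∘ e cons        = refl
cren-∘ e lrec        = refl
cren-∘ e (lam t)     = cong lam (cren-∘ e t)
cren-∘ e (app t s)   = cong₂ app (cren-∘ e t) (cren-∘ e s)
cren-∘ e (catch t)   = cong catch (cren-∘ (ext-∘ e) t)
cren-∘ e (throw α t) = cong₂ throw (e α) (cren-∘ e t)

cren-id : {θ : Fin m → Fin m} → θ ≗ id → (t : Term n m) → cren θ t ≡ t
cren-id e (var x)     = refl
cren-id e ⟨⟩          = refl
cren-id e nil         = refl
cren-id e cons        = refl
cren-id e lrec        = refl
cren-id e (lam t)     = cong lam (cren-id e t)
cren-id e (app t s)   = cong₂ app (cren-id e t) (cren-id e s)
cren-id e (catch t)   = cong catch (cren-id (ext-id e) t)
cren-id e (throw α t) = cong₂ throw (e α) (cren-id e t)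

ren-∘ : {ρ₁ : Fin n → Fin n'} {ρ₂ : Fin n' → Fin n''} {ρ : Fin n → Fin n''} →
  ρ₂ ∘ ρ₁ ≗ ρ → (t : Term n m) → ren ρ₂ (ren ρ₁ t) ≡ ren ρ t
ren-∘ e (var x)     = cong var (e x)
ren-∘ e ⟨⟩          = refl
ren-∘ e nil         = refl
ren-∘ e cons        = refl
ren-∘ e lrec        = refl
ren-∘ e (lam t)     = cong lam (ren-∘ (ext-∘ e) t)
ren-∘ e (app t s)   = cong₂ app (ren-∘ e t) (ren-∘ e s)
ren-∘ e (catch t)   = cong catch (ren-∘ e t)
ren-∘ e (throw α t) = cong (throw α) (ren-∘ e t)

ren-cren-comm : (ρ : Fin n → Fin n') (θ : Fin m → Fin m') (t : Term n m) →
  ren ρ (cren θ t) ≡ cren θ (ren ρ t)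
ren-cren-comm ρ θ (var x)     = refl
ren-cren-comm ρ θ ⟨⟩          = refl
ren-cren-comm ρ θ nil         = refl
ren-cren-comm ρ θ cons        = refl
ren-cren-comm ρ θ lrec        = refl
ren-cren-comm ρ θ (lam t)     = cong lam (ren-cren-comm (ext ρ) θ t)
ren-cren-comm ρ θ (app t s)   = cong₂ app (ren-cren-comm ρ θ t) (ren-cren-comm ρ θ s)
ren-cren-comm ρ θ (catch t)   = cong catch (ren-cren-comm ρ (ext θ) t)
ren-cren-comm ρ θ (throw α t) = cong (throw (θ α)) (ren-cren-comm ρ θ t)

exts-ext : {ρ : Fin n → Fin n'} {σ : Fin n' → Term n'' m} {σ' : Fin n → Term n'' m} →
  σ ∘ ρ ≗ σ' → exts σ ∘ ext ρ ≗ exts σ'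
exts-ext e zero    = refl
exts-ext e (suc i) = cong (ren suc) (e i)

subst-ren : {ρ : Fin n → Fin n'} {σ : Fin n' → Term n'' m} {σ' : Fin n → Term n'' m} →
  σ ∘ ρ ≗ σ' → (t : Term n m) → subst σ (ren ρ t) ≡ subst σ' t
subst-ren e (var x)     = e x
subst-ren e ⟨⟩          = refl
subst-ren e nil         = refl
subst-ren e cons        = refl
subst-ren e lrec        = refl
subst-ren e (lam t)     = cong lam (subst-ren (exts-ext e) t)
subst-ren e (app t s)   = cong₂ app (subst-ren e t) (subst-ren e s)
subst-ren e (catch t)   = cong catch (subst-ren (cong (cren suc) ∘ e) t)
subst-ren e (throw α t) = cong (throw α) (subst-ren e t)

ren-exts : {ρ : Fin n' → Fin n''} {σ : Fin n → Term n' m} {σ' : Fin n → Term n'' m} →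
  ren ρ ∘ σ ≗ σ' → ren (ext ρ) ∘ exts σ ≗ exts σ'
ren-exts e zero = refl
ren-exts {σ = σ} e (suc i) =
  trans (ren-∘ (λ _ → refl) (σ i)) (trans (sym (ren-∘ (λ _ → refl) (σ i))) (cong (ren suc) (e i)))

ren-subst : {ρ : Fin n' → Fin n''} {σ : Fin n → Term n' m} {σ' : Fin n → Term n'' m} →
  ren ρ ∘ σ ≗ σ' → (t : Term n m) → ren ρ (subst σ t) ≡ subst σ' t
ren-subst e (var x)     = e x
ren-subst e ⟨⟩          = refl
ren-subst e nil         = refl
ren-subst e cons        = refl
ren-subst e lrec        = refl
ren-subst e (lam t)     = cong lam (ren-subst (ren-exts e) t)
ren-subst e (app t s)   = cong₂ app (ren-subst e t) (ren-subst e s)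
ren-subst {ρ = ρ} {σ} e (catch t) =
  cong catch (ren-subst (λ i → trans (ren-cren-comm ρ suc (σ i)) (cong (cren suc) (e i))) t)
ren-subst e (throw α t) = cong (throw α) (ren-subst e t)

cren-ext-suc : (θ : Fin m → Fin m') (v : Term n m) → cren (ext θ) (cren suc v) ≡ cren suc (cren θ v)
cren-ext-suc θ v = trans (cren-∘ (λ _ → refl) v) (sym (cren-∘ (λ _ → refl) v))

cren-exts : {θ : Fin m → Fin m'} {σ : Fin n → Term n' m} {σ' : Fin n → Term n' m'} →
  cren θ ∘ σ ≗ σ' → cren θ ∘ exts σ ≗ exts σ'
cren-exts e zero = refl
cren-exts {θ = θ} {σ} e (suc i) = trans (sym (ren-cren-comm suc θ (σ i))) (cong (ren suc) (e i))

cren-subst : {θ : Fin m → Fin m'} {σ : Fin n → Term n' m} {σ' : Fin n → Term n' m'} →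
  cren θ ∘ σ ≗ σ' → (t : Term n m) → cren θ (subst σ t) ≡ subst σ' (cren θ t)
cren-subst e (var x)     = e x
cren-subst e ⟨⟩          = refl
cren-subst e nil         = refl
cren-subst e cons        = refl
cren-subst e lrec        = refl
cren-subst e (lam t)     = cong lam (cren-subst (cren-exts e) t)
cren-subst e (app t s)   = cong₂ app (cren-subst e t) (cren-subst e s)
cren-subst {θ = θ} {σ} e (catch t) =
  cong catch (cren-subst (λ i → trans (cren-ext-suc θ (σ i)) (cong (cren suc) (e i))) t)
cren-subst e (throw α t) = cong (throw _) (cren-subst e t)

subst-exts : {τ : Fin n' → Term n'' m} {σ : Fin n → Term n' m} {σ' : Fin n → Term n'' m} →
  subst τ ∘ σ ≗ σ' → subst (exts τ) ∘ exts σ ≗ exts σ'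
subst-exts e zero = refl
subst-exts {σ = σ} e (suc i) =
  trans (subst-ren (λ _ → refl) (σ i)) (trans (sym (ren-subst (λ _ → refl) (σ i))) (cong (ren suc) (e i)))

subst-subst : {τ : Fin n' → Term n'' m} {σ : Fin n → Term n' m} {σ' : Fin n → Term n'' m} →
  subst τ ∘ σ ≗ σ' → (t : Term n m) → subst τ (subst σ t) ≡ subst σ' t
subst-subst e (var x)     = e x
subst-subst e ⟨⟩          = refl
subst-subst e nil         = refl
subst-subst e cons        = refl
subst-subst e lrec        = refl
subst-subst e (lam t)     = cong lam (subst-subst (subst-exts e) t)
subst-subst {σ = σ} e (catch t) =
  cong catch (subst-subst (λ i → trans (sym (cren-subst (λ _ → refl) (σ i))) (cong (cren suc) (e i))) t)
subst-subst e (app t s)   = cong₂ app (subst-subst e t) (subst-subst e s)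
subst-subst e (throw α t) = cong (throw α) (subst-subst e t)

subst-id : {σ : Fin n → Term n m} → σ ≗ var → (t : Term n m) → subst σ t ≡ t
subst-id e (var x)     = e x
subst-id e ⟨⟩          = refl
subst-id e nil         = refl
subst-id e cons        = refl
subst-id e lrec        = refl
subst-id {σ = σ} e (lam t) = cong lam (subst-id exts-e t)
  where
  exts-e : exts σ ≗ var
  exts-e zero    = refl
  exts-e (suc i) = cong (ren suc) (e i)
subst-id e (app t s)   = cong₂ app (subst-id e t) (subst-id e s)
subst-id e (catch t)   = cong catch (subst-id (cong (cren suc) ∘ e) t)
subst-id e (throw α t) = cong (throw α) (subst-id e t)

extend : (Fin n → Term n' m) → Term n' m → Fin (suc n) → Term n' m
extend σ v zero    = v
extend σ v (suc i) = σ i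

[0:=]-weaken : (v x : Term n m) → ren suc x [0:= v ] ≡ x
[0:=]-weaken v x = trans (subst-ren (λ _ → refl) x) (subst-id (λ _ → refl) x)

exts-[0:=] : (σ : Fin n → Term n' m) (v : Term n' m) (b : Term (suc n) m) →
  subst (exts σ) b [0:= v ] ≡ subst (extend σ v) b
exts-[0:=] σ v = subst-subst single-exts
  where
  single-exts : subst (single v) ∘ exts σ ≗ extend σ v
  single-exts zero    = refl
  single-exts (suc i) = [0:=]-weaken v (σ i)

subst-[0:=] : (σ : Fin n → Term n' m) (v : Term n m) (b : Term (suc n) m) →
  subst σ (b [0:= v ]) ≡ subst (exts σ) b [0:= subst σ v ]
subst-[0:=] σ v b = trans (subst-subst extend-single b) (sym (exts-[0:=] σ (subst σ v) b))
  where
  extend-single : subst σ ∘ single v ≗ extend σ (subst σ v)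
  extend-single zero    = refl
  extend-single (suc i) = refl

cren-[0:=] : (θ : Fin m → Fin m') (b : Term (suc n) m) (v : Term n m) →
  cren θ (b [0:= v ]) ≡ cren θ b [0:= cren θ v ]
cren-[0:=] θ b v = cren-subst cren-single b
  where
  cren-single : cren θ ∘ single v ≗ single (cren θ v)
  cren-single zero    = refl
  cren-single (suc i) = refl

Value-cren : (θ : Fin m → Fin m') {v : Term n m} → Value v → Value (cren θ v)
Value-cren θ (var x)     = var x
Value-cren θ ⟨⟩          = ⟨⟩
Value-cren θ nil         = nil
Value-cren θ cons₀       = cons₀
Value-cren θ (cons₁ p)   = cons₁ (Value-cren θ p)
Value-cren θ (cons₂ p q) = cons₂ (Value-cren θ p) (Value-cren θ q)
Value-cren θ lrec₀       = lrec₀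
Value-cren θ (lrec₁ p)   = lrec₁ (Value-cren θ p)
Value-cren θ (lrec₂ p q) = lrec₂ (Value-cren θ p) (Value-cren θ q)
Value-cren θ (lam r)     = lam (cren θ r)

Value-ren : (ρ : Fin n → Fin n') {v : Term n m} → Value v → Value (ren ρ v)
Value-ren ρ (var x)     = var (ρ x)
Value-ren ρ ⟨⟩          = ⟨⟩
Value-ren ρ nil         = nil
Value-ren ρ cons₀       = cons₀
Value-ren ρ (cons₁ p)   = cons₁ (Value-ren ρ p)
Value-ren ρ (cons₂ p q) = cons₂ (Value-ren ρ p) (Value-ren ρ q)
Value-ren ρ lrec₀       = lrec₀
Value-ren ρ (lrec₁ p)   = lrec₁ (Value-ren ρ p)
Value-ren ρ (lrec₂ p q) = lrec₂ (Value-ren ρ p) (Value-ren ρ q)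
Value-ren ρ (lam r)     = lam (ren (ext ρ) r)

ValueSubst : (Fin n → Term n' m) → Set
ValueSubst σ = ∀ i → Value (σ i)

Value-subst : {σ : Fin n → Term n' m} → ValueSubst σ → {v : Term n m} → Value v → Value (subst σ v)
Value-subst vσ (var x)     = vσ x
Value-subst vσ ⟨⟩          = ⟨⟩
Value-subst vσ nil         = nil
Value-subst vσ cons₀       = cons₀
Value-subst vσ (cons₁ p)   = cons₁ (Value-subst vσ p)
Value-subst vσ (cons₂ p q) = cons₂ (Value-subst vσ p) (Value-subst vσ q)
Value-subst vσ lrec₀       = lrec₀
Value-subst vσ (lrec₁ p)   = lrec₁ (Value-subst vσ p)
Value-subst vσ (lrec₂ p q) = lrec₂ (Value-subst vσ p) (Value-subst vσ q)
Value-subst {σ = σ} vσ (lam r) = lam (subst (exts σ) r)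

ValueSubst-exts : {σ : Fin n → Term n' m} → ValueSubst σ → ValueSubst (exts σ)
ValueSubst-exts vσ zero    = var zero
ValueSubst-exts vσ (suc i) = Value-ren suc (vσ i)

ValueSubst-cren : (θ : Fin m → Fin m') {σ : Fin n → Term n' m} → ValueSubst σ → ValueSubst (cren θ ∘ σ)
ValueSubst-cren θ vσ = Value-cren θ ∘ vσ

ValueSubst-single : {v : Term n m} → Value v → ValueSubst (single v)
ValueSubst-single p zero    = p
ValueSubst-single p (suc i) = var i

ValueSubst-extend : {σ : Fin n → Term n' m} {v : Term n' m} → ValueSubst σ → Value v → ValueSubst (extend σ v)
ValueSubst-extend vσ p zero    = p
ValueSubst-extend vσ p (suc i) = vσ i

Value-cren⁻ : (θ : Fin m → Fin m') (v : Term n m) → Value (cren θ v) → Value v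
Value-cren⁻ θ (var x)               _           = var x
Value-cren⁻ θ ⟨⟩                    _           = ⟨⟩
Value-cren⁻ θ nil                   _           = nil
Value-cren⁻ θ cons                  _           = cons₀
Value-cren⁻ θ lrec                  _           = lrec₀
Value-cren⁻ θ (lam r)               _           = lam r
Value-cren⁻ θ (app cons v)          (cons₁ p)   = cons₁ (Value-cren⁻ θ v p)
Value-cren⁻ θ (app lrec v)          (lrec₁ p)   = lrec₁ (Value-cren⁻ θ v p)
Value-cren⁻ θ (app (app cons v) w)  (cons₂ p q) = cons₂ (Value-cren⁻ θ v p) (Value-cren⁻ θ w q)
Value-cren⁻ θ (app (app lrec v) w)  (lrec₂ p q) = lrec₂ (Value-cren⁻ θ v p) (Value-cren⁻ θ w q)

↦-cren : (θ : Fin m → Fin m') {t u : Term n m} → t ↦ u → cren θ t ↦ cren θ u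
↦-cren θ (β {t} {v} p) =
  transport (app (lam (cren θ t)) (cren θ v) ↦_) (sym (cren-[0:=] θ t v)) (β (Value-cren θ p))
↦-cren θ throwₗ             = throwₗ
↦-cren θ (throwᵣ p)         = throwᵣ (Value-cren θ p)
↦-cren θ throwₜ             = throwₜ
↦-cren θ catch-throw-same   = catch-throw-same
↦-cren θ (catch-throw-other {γ} {v} p) =
  transport (λ z → catch (throw (suc (θ γ)) z) ↦ throw (θ γ) (cren θ v))
    (sym (cren-ext-suc θ v)) (catch-throw-other (Value-cren θ p))
↦-cren θ (catch-val {v} p) =
  transport (λ z → catch z ↦ cren θ v) (sym (cren-ext-suc θ v)) (catch-val (Value-cren θ p))
↦-cren θ (lrec-nil p q)      = lrec-nil (Value-cren θ p) (Value-cren θ q)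
↦-cren θ (lrec-cons p q r s) = lrec-cons (Value-cren θ p) (Value-cren θ q) (Value-cren θ r) (Value-cren θ s)

⟶-cren : (θ : Fin m → Fin m') {t u : Term n m} → t ⟶ u → cren θ t ⟶ cren θ u
⟶-cren θ (root r)    = root (↦-cren θ r)
⟶-cren θ (ξ-lam s)   = ξ-lam (⟶-cren θ s)
⟶-cren θ (ξ-appₗ s)  = ξ-appₗ (⟶-cren θ s)
⟶-cren θ (ξ-appᵣ s)  = ξ-appᵣ (⟶-cren θ s)
⟶-cren θ (ξ-catch s) = ξ-catch (⟶-cren (ext θ) s)
⟶-cren θ (ξ-throw s) = ξ-throw (⟶-cren θ s)

↦-subst : {σ : Fin n → Term n' m} → ValueSubst σ → {t u : Term n m} → t ↦ u → subst σ t ↦ subst σ u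
↦-subst {σ = σ} vσ (β {t} {v} p) =
  transport (app (lam (subst (exts σ) t)) (subst σ v) ↦_) (sym (subst-[0:=] σ v t)) (β (Value-subst vσ p))
↦-subst vσ throwₗ           = throwₗ
↦-subst vσ (throwᵣ p)       = throwᵣ (Value-subst vσ p)
↦-subst vσ throwₜ           = throwₜ
↦-subst vσ catch-throw-same = catch-throw-same
↦-subst {σ = σ} vσ (catch-throw-other {γ} {v} p) =
  transport (λ z → catch (throw (suc γ) z) ↦ throw γ (subst σ v))
    (cren-subst (λ _ → refl) v) (catch-throw-other (Value-subst vσ p))
↦-subst {σ = σ} vσ (catch-val {v} p) =
  transport (λ z → catch z ↦ subst σ v) (cren-subst (λ _ → refl) v) (catch-val (Value-subst vσ p))
↦-subst vσ (lrec-nil p q)      = lrec-nil (Value-subst vσ p) (Value-subst vσ q)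
↦-subst vσ (lrec-cons p q r s) =
  lrec-cons (Value-subst vσ p) (Value-subst vσ q) (Value-subst vσ r) (Value-subst vσ s)

⟶-subst : {σ : Fin n → Term n' m} → ValueSubst σ → {t u : Term n m} → t ⟶ u → subst σ t ⟶ subst σ u
⟶-subst vσ (root r)    = root (↦-subst vσ r)
⟶-subst vσ (ξ-lam s)   = ξ-lam (⟶-subst (ValueSubst-exts vσ) s)
⟶-subst vσ (ξ-appₗ s)  = ξ-appₗ (⟶-subst vσ s)
⟶-subst vσ (ξ-appᵣ s)  = ξ-appᵣ (⟶-subst vσ s)
⟶-subst vσ (ξ-catch s) = ξ-catch (⟶-subst (ValueSubst-cren suc vσ) s)
⟶-subst vσ (ξ-throw s) = ξ-throw (⟶-subst vσ s)

lam-injective : {t t' : Term (suc n) m} → Term.lam t ≡ lam t' → t ≡ t'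
lam-injective refl = refl

app-injective : {t t' s s' : Term n m} → app t s ≡ app t' s' → t ≡ t' × s ≡ s'
app-injective refl = refl , refl

catch-injective : {t t' : Term n (suc m)} → catch t ≡ catch t' → t ≡ t'
catch-injective refl = refl

throw-injective : {α α' : Fin m} {t t' : Term n m} → throw α t ≡ throw α' t' → α ≡ α' × t ≡ t'
throw-injective refl = refl , refl

PullsBack : (θ : Fin m → Fin m'') (ρ : Fin m' → Fin m'') (ι : Fin n → Fin m) (ψ : Fin n → Fin m') → Set
PullsBack θ ρ ι ψ = ∀ {α j} → ρ j ≡ θ α → ∃ λ k → α ≡ ι k × j ≡ ψ k

PullsBack-ext : {θ : Fin m → Fin m''} {ρ : Fin m' → Fin m''} {ι : Fin n → Fin m} {ψ : Fin n → Fin m'} →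
  PullsBack θ ρ ι ψ → PullsBack (ext θ) (ext ρ) (ext ι) (ext ψ)
PullsBack-ext pb {zero}  {zero}  refl = zero , refl , refl
PullsBack-ext pb {suc α} {suc j} eq with pb (suc-injective eq)
... | k , refl , refl = suc k , refl , refl

cren-pullback : {θ : Fin m → Fin m''} {ρ : Fin m' → Fin m''} {ι : Fin n' → Fin m} {ψ : Fin n' → Fin m'} →
  PullsBack θ ρ ι ψ → (t : Term n m) {v : Term n m'} →
  cren ρ v ≡ cren θ t → ∃ λ t₀ → t ≡ cren ι t₀ × v ≡ cren ψ t₀
cren-pullback pb (var x) {var _} refl = var x , refl , refl
cren-pullback pb ⟨⟩      {⟨⟩}    refl = ⟨⟩ , refl , refl
cren-pullback pb nil     {nil}   refl = nil , refl , refl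
cren-pullback pb cons    {cons}  refl = cons , refl , refl
cren-pullback pb lrec    {lrec}  refl = lrec , refl , refl
cren-pullback pb (lam t) {lam v} eq with cren-pullback pb t {v} (lam-injective eq)
... | t₀ , refl , refl = lam t₀ , refl , refl
cren-pullback pb (app t s) {app v w} eq with app-injective eq
... | eqₜ , eqₛ with cren-pullback pb t {v} eqₜ | cren-pullback pb s {w} eqₛ
... | t₀ , refl , refl | s₀ , refl , refl = app t₀ s₀ , refl , refl
cren-pullback pb (catch t) {catch v} eq with cren-pullback (PullsBack-ext pb) t {v} (catch-injective eq)
... | t₀ , refl , refl = catch t₀ , refl , refl
cren-pullback pb (throw α t) {throw γ v} eq with throw-injective eq
... | eqα , eqₜ with pb eqα | cren-pullback pb t {v} eqₜ
... | k , refl , refl | t₀ , refl , refl = throw k t₀ , refl , refl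

cren-injective : {ρ : Fin m → Fin m'} → (∀ {i j} → ρ i ≡ ρ j → i ≡ j) →
  {v v' : Term n m} → cren ρ v ≡ cren ρ v' → v ≡ v'
cren-injective inj {v} {v'} eq with cren-pullback {ι = id} {ψ = id} (λ e → _ , inj (sym e) , refl) v' eq
... | t₀ , refl , refl = refl

PullsBack-suc : (θ : Fin m → Fin m') → PullsBack (ext θ) suc suc θ
PullsBack-suc θ {suc k} refl = k , refl , refl

CrenPreimage : (Term n m → Term n m → Set) → (θ : Fin m → Fin m') → Term n m → Term n m' → Set
CrenPreimage _R_ θ t u = ∃ λ t' → t R t' × u ≡ cren θ t'

-- The redex indices are given as equations, since unification gets stuck on  cren θ a .
module _ (θ : Fin m → Fin m') where

  private
    catch-↦-cren⁻ : (w : Term n (suc m)) {x : Term n (suc m')} {u : Term n m'} →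
      catch x ↦ u → x ≡ cren (ext θ) w → CrenPreimage _↦_ θ (catch w) u
    catch-↦-cren⁻ (throw zero t) catch-throw-same refl = catch t , catch-throw-same , refl
    -- The body  throw (suc γ) (cren suc v)  of this redex is  cren suc (throw γ v)  on the nose.
    catch-↦-cren⁻ w (catch-throw-other p) eq with cren-pullback (PullsBack-suc θ) w eq
    ... | throw γ v , refl , refl = throw γ v , catch-throw-other (Value-cren⁻ θ v p) , refl
    catch-↦-cren⁻ w (catch-val p) eq with cren-pullback (PullsBack-suc θ) w eq
    ... | v , refl , refl = v , catch-val (Value-cren⁻ θ v p) , refl

    app-↦-cren⁻ : (a b : Term n m) {x y u : Term n m'} →
      app x y ↦ u → x ≡ cren θ a → y ≡ cren θ b → CrenPreimage _↦_ θ (app a b) u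
    app-↦-cren⁻ (lam a) b (β p) refl refl = a [0:= b ] , β (Value-cren⁻ θ b p) , sym (cren-[0:=] θ a b)
    app-↦-cren⁻ (throw α a) b throwₗ refl refl = throw α a , throwₗ , refl
    app-↦-cren⁻ a (throw α b) (throwᵣ p) refl refl = throw α b , throwᵣ (Value-cren⁻ θ a p) , refl
    app-↦-cren⁻ (app (app lrec r) s) nil (lrec-nil p q) refl refl =
      r , lrec-nil (Value-cren⁻ θ r p) (Value-cren⁻ θ s q) , refl
    app-↦-cren⁻ (app (app lrec r) s) (app (app cons h) l) (lrec-cons p q p' q') refl refl =
      app (app (app s h) l) (app (app (app lrec r) s) l) ,
      lrec-cons (Value-cren⁻ θ r p) (Value-cren⁻ θ s q) (Value-cren⁻ θ h p') (Value-cren⁻ θ l q') , refl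

  ↦-cren⁻ : (t : Term n m) {u : Term n m'} → cren θ t ↦ u → CrenPreimage _↦_ θ t u
  ↦-cren⁻ (app a b) r = app-↦-cren⁻ a b r refl refl
  ↦-cren⁻ (throw γ (throw α t)) throwₜ = throw α t , throwₜ , refl
  ↦-cren⁻ (catch w) r = catch-↦-cren⁻ w r refl

⟶-cren⁻ : (θ : Fin m → Fin m') (t : Term n m) {u : Term n m'} → cren θ t ⟶ u → CrenPreimage _⟶_ θ t u
⟶-cren⁻ θ (lam t) (ξ-lam st) with ⟶-cren⁻ θ t st
... | t' , st' , refl = lam t' , ξ-lam st' , refl
⟶-cren⁻ θ (app a b) (ξ-appₗ st) with ⟶-cren⁻ θ a st
... | a' , st' , refl = app a' b , ξ-appₗ st' , refl
⟶-cren⁻ θ (app a b) (ξ-appᵣ st) with ⟶-cren⁻ θ b st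
... | b' , st' , refl = app a b' , ξ-appᵣ st' , refl
⟶-cren⁻ θ (catch t) (ξ-catch st) with ⟶-cren⁻ (ext θ) t st
... | t' , st' , refl = catch t' , ξ-catch st' , refl
⟶-cren⁻ θ (throw α t) (ξ-throw st) with ⟶-cren⁻ θ t st
... | t' , st' , refl = throw α t' , ξ-throw st' , refl
⟶-cren⁻ θ t (root r) with ↦-cren⁻ θ t r
... | t' , r' , eq = t' , root r' , eq

-- Strong normalisation

-- Besides the reducts, Sn also records the immediate subterms as strongly normalising, so that
-- they are structurally smaller; Sn-catch needs this for  catch α (throw α t) → catch α t .
mutual
  data Sn {n m} (t : Term n m) : Set where
    sn : (∀ {u} → t ⟶ u → Sn u) → SnSub t → Sn t

  data SnSub {n m} : Term n m → Set where
    var   : ∀ {x} → SnSub (var x)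
    ⟨⟩    : SnSub ⟨⟩
    nil   : SnSub nil
    cons  : SnSub cons
    lrec  : SnSub lrec
    lam   : ∀ {t} → Sn t → SnSub (lam t)
    app   : ∀ {t s} → Sn t → Sn s → SnSub (app t s)
    catch : ∀ {t} → Sn t → SnSub (catch t)
    throw : ∀ {α t} → Sn t → SnSub (throw α t)

Sn-⟶ : {t u : Term n m} → Sn t → t ⟶ u → Sn u
Sn-⟶ (sn h _) st = h st

mutual
  Sn-cren⁻ : (θ : Fin m → Fin m') (t : Term n m) → Sn (cren θ t) → Sn t
  Sn-cren⁻ θ t (sn h sub) = sn (λ st → Sn-cren⁻ θ _ (h (⟶-cren θ st))) (SnSub-cren⁻ θ t sub)

  SnSub-cren⁻ : (θ : Fin m → Fin m') (t : Term n m) → SnSub (cren θ t) → SnSub t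
  SnSub-cren⁻ θ (var x)     _          = var
  SnSub-cren⁻ θ ⟨⟩          _          = ⟨⟩
  SnSub-cren⁻ θ nil         _          = nil
  SnSub-cren⁻ θ cons        _          = cons
  SnSub-cren⁻ θ lrec        _          = lrec
  SnSub-cren⁻ θ (lam t)     (lam s)    = lam (Sn-cren⁻ θ t s)
  SnSub-cren⁻ θ (app t s)   (app a b)  = app (Sn-cren⁻ θ t a) (Sn-cren⁻ θ s b)
  SnSub-cren⁻ θ (catch t)   (catch s)  = catch (Sn-cren⁻ (ext θ) t s)
  SnSub-cren⁻ θ (throw α t) (throw s)  = throw (Sn-cren⁻ θ t s)

mutual
  Sn-subst⁻ : {σ : Fin n → Term n' m} → ValueSubst σ → (t : Term n m) → Sn (subst σ t) → Sn t
  Sn-subst⁻ vσ t (sn h sub) = sn (λ st → Sn-subst⁻ vσ _ (h (⟶-subst vσ st))) (SnSub-subst⁻ vσ t sub)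

  SnSub-subst⁻ : {σ : Fin n → Term n' m} → ValueSubst σ → (t : Term n m) → SnSub (subst σ t) → SnSub t
  SnSub-subst⁻ vσ (var x)     _         = var
  SnSub-subst⁻ vσ ⟨⟩          _         = ⟨⟩
  SnSub-subst⁻ vσ nil         _         = nil
  SnSub-subst⁻ vσ cons        _         = cons
  SnSub-subst⁻ vσ lrec        _         = lrec
  SnSub-subst⁻ vσ (lam t)     (lam s)   = lam (Sn-subst⁻ (ValueSubst-exts vσ) t s)
  SnSub-subst⁻ vσ (app t s)   (app a b) = app (Sn-subst⁻ vσ t a) (Sn-subst⁻ vσ s b)
  SnSub-subst⁻ vσ (catch t)   (catch s) = catch (Sn-subst⁻ (ValueSubst-cren suc vσ) t s)
  SnSub-subst⁻ vσ (throw α t) (throw s) = throw (Sn-subst⁻ vσ t s)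

mutual
  Sn-cren : (θ : Fin m → Fin m') {t : Term n m} → Sn t → Sn (cren θ t)
  Sn-cren θ {t} (sn h sub) = sn reducts (SnSub-cren θ sub)
    where
    reducts : ∀ {u} → cren θ t ⟶ u → Sn u
    reducts st with ⟶-cren⁻ θ t st
    ... | t' , st' , refl = Sn-cren θ (h st')

  SnSub-cren : (θ : Fin m → Fin m') {t : Term n m} → SnSub t → SnSub (cren θ t)
  SnSub-cren θ var       = var
  SnSub-cren θ ⟨⟩        = ⟨⟩
  SnSub-cren θ nil       = nil
  SnSub-cren θ cons      = cons
  SnSub-cren θ lrec      = lrec
  SnSub-cren θ (lam s)   = lam (Sn-cren θ s)
  SnSub-cren θ (app a b) = app (Sn-cren θ a) (Sn-cren θ b)
  SnSub-cren θ (catch s) = catch (Sn-cren (ext θ) s)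
  SnSub-cren θ (throw s) = throw (Sn-cren θ s)

Sn-throw : {α : Fin m} {w : Term n m} → Sn w → Sn (throw α w)
Sn-throw s = sn (reducts s) (throw s)
  where
  reducts : ∀ {α w u} → Sn w → throw α w ⟶ u → Sn u
  reducts (sn h _) (ξ-throw st) = Sn-throw (h st)
  reducts s        (root throwₜ) = s

Sn-lam : {t : Term (suc n) m} → Sn t → Sn (lam t)
Sn-lam s = sn (reducts s) (lam s)
  where
  reducts : ∀ {t u} → Sn t → lam t ⟶ u → Sn u
  reducts (sn h _) (ξ-lam st) = Sn-lam (h st)

Sn-catch : {t : Term n (suc m)} → Sn t → Sn (catch t)
Sn-catch s = sn (reducts s) (catch s)
  where
  reducts : ∀ {t u} → Sn t → catch t ⟶ u → Sn u
  reducts (sn h _)         (ξ-catch st)                 = Sn-catch (h st)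
  reducts s                (root (catch-val _))         = Sn-cren⁻ suc _ s
  reducts (sn _ (throw s)) (root catch-throw-same)      = Sn-catch s
  reducts (sn _ (throw s)) (root (catch-throw-other _)) = Sn-throw (Sn-cren⁻ suc _ s)

data ThrowHeaded {n m} : Term n m → Set where
  throw : ∀ {α w} → ThrowHeaded (throw α w)
  app   : ∀ {t s} → ThrowHeaded t → ThrowHeaded (app t s)

ThrowHeaded-⟶ : {t u : Term n m} → ThrowHeaded t → t ⟶ u → ThrowHeaded u
ThrowHeaded-⟶ throw   (ξ-throw _)         = throw
ThrowHeaded-⟶ throw   (root throwₜ)       = throw
ThrowHeaded-⟶ (app h) (ξ-appₗ st)         = app (ThrowHeaded-⟶ h st)
ThrowHeaded-⟶ (app h) (ξ-appᵣ _)          = app h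
ThrowHeaded-⟶ (app h) (root throwₗ)       = throw
ThrowHeaded-⟶ (app h) (root (throwᵣ _))   = throw
ThrowHeaded-⟶ (app ()) (root (β _))
ThrowHeaded-⟶ (app (app (app ()))) (root (lrec-nil _ _))
ThrowHeaded-⟶ (app (app (app ()))) (root (lrec-cons _ _ _ _))

-- Operators t such that app t s can only make throw-steps at the root, stably under reduction.
data Inert {n m} : Term n m → Set where
  cons   : Inert cons
  lrec   : Inert lrec
  cons₁  : ∀ {a} → Inert (app cons a)
  lrec₁  : ∀ {a} → Inert (app lrec a)
  thrown : ∀ {t} → ThrowHeaded t → Inert t

Inert-⟶ : {t u : Term n m} → Inert t → t ⟶ u → Inert u
Inert-⟶ cons₁      (ξ-appᵣ _)        = cons₁
Inert-⟶ cons₁      (root (throwᵣ _)) = thrown throw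
Inert-⟶ lrec₁      (ξ-appᵣ _)        = lrec₁
Inert-⟶ lrec₁      (root (throwᵣ _)) = thrown throw
Inert-⟶ (thrown h) st                = thrown (ThrowHeaded-⟶ h st)
Inert-⟶ cons₁      (ξ-appₗ (root ()))
Inert-⟶ lrec₁      (ξ-appₗ (root ()))
Inert-⟶ cons       (root ())
Inert-⟶ lrec       (root ())

Sn-app-inert : {t s : Term n m} → Inert t → Sn t → Sn s → Sn (app t s)
Sn-app-inert i st ss = sn (reducts i st ss) (app st ss)
  where
  reducts : ∀ {t s u} → Inert t → Sn t → Sn s → app t s ⟶ u → Sn u
  reducts i (sn h _) ss       (ξ-appₗ r)        = Sn-app-inert (Inert-⟶ i r) (h r) ss
  reducts i st       (sn h _) (ξ-appᵣ r)        = Sn-app-inert i st (h r)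
  reducts i st       ss       (root throwₗ)     = st
  reducts i st       ss       (root (throwᵣ _)) = ss
  reducts (thrown ()) _ _ (root (β _))
  reducts (thrown (app (app ()))) _ _ (root (lrec-nil _ _))
  reducts (thrown (app (app ()))) _ _ (root (lrec-cons _ _ _ _))

-- Reducibility

-- Applying a neutral term never creates a β- or lrec-redex, and a neutral term is not a cons-cell.
data Intro {n m} : Term n m → Set where
  lam   : ∀ {t} → Intro (lam t)
  cons  : Intro cons
  cons₁ : ∀ {a} → Intro (app cons a)
  cons₂ : ∀ {a b} → Intro (app (app cons a) b)
  lrec  : Intro lrec
  lrec₁ : ∀ {a} → Intro (app lrec a)
  lrec₂ : ∀ {a b} → Intro (app (app lrec a) b)

Neutral : Term n m → Set
Neutral t = ¬ Intro t

Neutral-cren : (θ : Fin m → Fin m') (t : Term n m) → Neutral t → Neutral (cren θ t)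
Neutral-cren θ (lam t)              ne lam   = ne lam
Neutral-cren θ cons                 ne cons  = ne cons
Neutral-cren θ (app cons a)         ne cons₁ = ne cons₁
Neutral-cren θ (app (app cons a) b) ne cons₂ = ne cons₂
Neutral-cren θ lrec                 ne lrec  = ne lrec
Neutral-cren θ (app lrec a)         ne lrec₁ = ne lrec₁
Neutral-cren θ (app (app lrec a) b) ne lrec₂ = ne lrec₂

Neutral-app : {t : Term n m} (s : Term n m) → Neutral t → Neutral (app t s)
Neutral-app s ne cons₁ = ne cons
Neutral-app s ne cons₂ = ne cons₁
Neutral-app s ne lrec₁ = ne lrec
Neutral-app s ne lrec₂ = ne lrec₁

ThrowHeaded-neutral : {t : Term n m} → ThrowHeaded t → Neutral t
ThrowHeaded-neutral (app (app ()))   cons₂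
ThrowHeaded-neutral (app (app ()))   lrec₂

cons-cell-cren⁻ : (θ : Fin m → Fin m') (t : Term n m) {a b : Term n m'} →
  cren θ t ≡ app (app cons a) b →
  ∃₂ λ a₀ b₀ → t ≡ app (app cons a₀) b₀ × a ≡ cren θ a₀ × b ≡ cren θ b₀
cons-cell-cren⁻ θ (app (app cons a₀) b₀) refl = a₀ , b₀ , refl , refl , refl

data RedList {n m} (P : Term n m → Set) (t : Term n m) : Set where
  redList : Sn t → (∀ {u} → t ⟶ u → RedList P u) →
    (∀ {a b} → t ≡ app (app cons a) b → P a × RedList P b) → RedList P t

-- Arrows quantify over renamings of continuation variables, so that reducibility survives
-- going under catch.
Red : Ty → Term n m → Set
Red unit     t = Sn t
Red (list σ) t = RedList (Red σ) t
Red {n} {m} (σ ⇒ τ) t =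
  Sn t × (∀ {m'} (θ : Fin m → Fin m') (s : Term n m') → Red σ s → Red τ (app (cren θ t) s))

Red⇒Sn : (ρ : Ty) {t : Term n m} → Red ρ t → Sn t
Red⇒Sn unit     r                 = r
Red⇒Sn (list σ) (redList s _ _)   = s
Red⇒Sn (σ ⇒ τ)  (s , _)           = s

Red-⟶ : (ρ : Ty) {t u : Term n m} → Red ρ t → t ⟶ u → Red ρ u
Red-⟶ unit     r                 st = Sn-⟶ r st
Red-⟶ (list σ) (redList _ h _)   st = h st
Red-⟶ (σ ⇒ τ)  (s , f)           st = Sn-⟶ s st , λ θ s' r → Red-⟶ τ (f θ s' r) (ξ-appₗ (⟶-cren θ st))

RedList-cren : (θ : Fin m → Fin m') {P : Term n m → Set} {Q : Term n m' → Set} →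
  (∀ {a} → P a → Q (cren θ a)) → {t : Term n m} → RedList P t → RedList Q (cren θ t)
RedList-cren θ {Q = Q} pq {t} (redList s h c) = redList (Sn-cren θ s) reducts cell
  where
  reducts : ∀ {u} → cren θ t ⟶ u → RedList Q u
  reducts st with ⟶-cren⁻ θ t st
  ... | t' , st' , refl = RedList-cren θ pq (h st')
  cell : ∀ {a b} → cren θ t ≡ app (app cons a) b → Q a × RedList Q b
  cell eq with cons-cell-cren⁻ θ t eq
  ... | a₀ , b₀ , refl , refl , refl with c refl
  ... | pa , rb = pq pa , RedList-cren θ pq rb

Red-cren : (ρ : Ty) (θ : Fin m → Fin m') {t : Term n m} → Red ρ t → Red ρ (cren θ t)
Red-cren unit     θ r = Sn-cren θ r
Red-cren (list σ) θ r = RedList-cren θ (Red-cren σ θ) r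
Red-cren (σ ⇒ τ)  θ {t} (s , f) = Sn-cren θ s ,
  λ θ' s' r → transport (λ z → Red τ (app z s')) (sym (cren-∘ (λ _ → refl) t)) (f (θ' ∘ θ) s' r)

Red-app : {σ τ : Ty} {f a : Term n m} → Red (σ ⇒ τ) f → Red σ a → Red τ (app f a)
Red-app {τ = τ} {f} {a} (_ , h) r = transport (λ z → Red τ (app z a)) (cren-id (λ _ → refl) f) (h id a r)

mutual
  Red-neutral : (ρ : Ty) {t : Term n m} → Neutral t → SnSub t → (∀ {u} → t ⟶ u → Red ρ u) → Red ρ t
  Red-neutral unit     ne sub h = sn (Red⇒Sn unit ∘ h) sub
  Red-neutral (list σ) ne sub h = redList (sn (Red⇒Sn (list σ) ∘ h) sub) h (λ { refl → ⊥-elim (ne cons₂) })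
  Red-neutral {m = m} (σ ⇒ τ) {t} ne sub h = snₜ ,
    λ θ s r → Red-app-neutral σ τ (Neutral-cren θ t ne) reducts-cren (Sn-cren θ snₜ) (Red⇒Sn σ r) r
    where
    snₜ : Sn t
    snₜ = sn (Red⇒Sn (σ ⇒ τ) ∘ h) sub
    reducts-cren : ∀ {m'} {θ : Fin m → Fin m'} {u} → cren θ t ⟶ u → Red (σ ⇒ τ) u
    reducts-cren {θ = θ} st with ⟶-cren⁻ θ t st
    ... | t' , st' , refl = Red-cren (σ ⇒ τ) θ (h st')

  Red-app-neutral : (σ τ : Ty) {t s : Term n m} → Neutral t → (∀ {u} → t ⟶ u → Red (σ ⇒ τ) u) →
    Sn t → Sn s → Red σ s → Red τ (app t s)
  Red-app-neutral σ τ {t} {s} ne h snₜ snₛ r =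
    Red-neutral τ (Neutral-app s ne) (app snₜ snₛ) (reducts snₛ r)
    where
    reducts : ∀ {s u} → Sn s → Red σ s → app t s ⟶ u → Red τ u
    reducts snₛ       r (ξ-appₗ st)       = Red-app (h st) r
    reducts (sn g _)  r (ξ-appᵣ st)       = Red-app-neutral σ τ ne h snₜ (g st) (Red-⟶ σ r st)
    reducts snₛ       r (root throwₗ)     = Red-throwHeaded τ snₜ throw
    reducts snₛ       r (root (throwᵣ _)) = Red-throwHeaded τ snₛ throw
    reducts snₛ       r (root (β _))      = ⊥-elim (ne lam)
    reducts snₛ       r (root (lrec-nil _ _))       = ⊥-elim (ne lrec₂)
    reducts snₛ       r (root (lrec-cons _ _ _ _))  = ⊥-elim (ne lrec₂)

  Red-throwHeaded : (ρ : Ty) {t : Term n m} → Sn t → ThrowHeaded t → Red ρ t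
  Red-throwHeaded ρ (sn h sub) th =
    Red-neutral ρ (ThrowHeaded-neutral th) sub (λ st → Red-throwHeaded ρ (h st) (ThrowHeaded-⟶ th st))

Sn-⟨⟩ : Sn {n} {m} ⟨⟩
Sn-⟨⟩ = sn (λ { (root ()) }) ⟨⟩

Sn-cons : Sn {n} {m} cons
Sn-cons = sn (λ { (root ()) }) cons

Sn-lrec : Sn {n} {m} lrec
Sn-lrec = sn (λ { (root ()) }) lrec

Red-var : (ρ : Ty) (x : Fin n) → Red {n} {m} ρ (var x)
Red-var ρ x = Red-neutral ρ (λ ()) var (λ { (root ()) })

Red-nil : (σ : Ty) → Red {n} {m} (list σ) nil
Red-nil σ = redList (sn (λ { (root ()) }) nil) (λ { (root ()) }) (λ ())

stuck : Term n m
stuck = app ⟨⟩ ⟨⟩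

Red-stuck : (τ : Ty) → Red {n} {m} τ stuck
Red-stuck τ = Red-neutral τ (λ ()) (app Sn-⟨⟩ Sn-⟨⟩) λ { (ξ-appₗ (root ())) ; (ξ-appᵣ (root ())) ; (root ()) }

LamBody : Ty → Ty → Term (suc n) m → Set
LamBody {n} {m} σ τ b =
  ∀ {m'} (θ : Fin m → Fin m') (v : Term n m') → Value v → Red σ v → Red τ (cren θ b [0:= v ])

LamBody-⟶ : (σ τ : Ty) {b b' : Term (suc n) m} → LamBody σ τ b → b ⟶ b' → LamBody σ τ b'
LamBody-⟶ σ τ H st θ v p r = Red-⟶ τ (H θ v p r) (⟶-subst (ValueSubst-single p) (⟶-cren θ st))

LamBody-cren : (σ τ : Ty) (θ : Fin m → Fin m') {b : Term (suc n) m} → LamBody σ τ b → LamBody σ τ (cren θ b)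
LamBody-cren σ τ θ {b} H θ' v p r =
  transport (λ z → Red τ (z [0:= v ])) (sym (cren-∘ (λ _ → refl) b)) (H (θ' ∘ θ) v p r)

Red-β : (σ τ : Ty) {b : Term (suc n) m} {s : Term n m} →
  Sn b → LamBody σ τ b → Sn s → Red σ s → Red τ (app (lam b) s)
Red-β σ τ snb H sns r = Red-neutral τ (λ ()) (app (Sn-lam snb) sns) (reducts snb H sns r)
  where
  reducts : ∀ {b s u} → Sn b → LamBody σ τ b → Sn s → Red σ s → app (lam b) s ⟶ u → Red τ u
  reducts (sn h _) H sns      r (ξ-appₗ (ξ-lam st)) = Red-β σ τ (h st) (LamBody-⟶ σ τ H st) sns r
  reducts snb      H (sn g _) r (ξ-appᵣ st)         = Red-β σ τ snb H (g st) (Red-⟶ σ r st)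
  reducts {b} {s} snb H sns r (root (β p)) =
    transport (λ z → Red τ (z [0:= s ])) (cren-id (λ _ → refl) b) (H id s p r)
  reducts snb      H sns      r (root (throwᵣ _))   = Red-throwHeaded τ sns throw

canonical : Ty → Term n m
canonical unit     = ⟨⟩
canonical (list σ) = nil
canonical (σ ⇒ τ)  = lam stuck

canonical-value : (ρ : Ty) → Value {n} {m} (canonical ρ)
canonical-value unit     = ⟨⟩
canonical-value (list σ) = nil
canonical-value (σ ⇒ τ)  = lam stuck

mutual
  canonical-red : (ρ : Ty) → Red {n} {m} ρ (canonical ρ)
  canonical-red unit     = Sn-⟨⟩
  canonical-red (list σ) = Red-nil σ
  canonical-red (σ ⇒ τ)  = Red-lam σ τ (λ θ v p r → Red-stuck τ)

  -- Strong normalisation of the body comes from instantiating it with a canonical value.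
  Red-lam : (σ τ : Ty) {b : Term (suc n) m} → LamBody σ τ b → Red (σ ⇒ τ) (lam b)
  Red-lam σ τ {b} H = Sn-lam snb , λ θ s r → Red-β σ τ (Sn-cren θ snb) (LamBody-cren σ τ θ {b} H) (Red⇒Sn σ r) r
    where
    snb : Sn b
    snb = Sn-cren⁻ id b (Sn-subst⁻ (ValueSubst-single (canonical-value σ)) (cren id b)
            (Red⇒Sn τ (H id (canonical σ) (canonical-value σ) (canonical-red σ))))

Sn-cons-cell : {a b : Term n m} → Sn a → Sn b → Sn (app (app cons a) b)
Sn-cons-cell sa sb = Sn-app-inert cons₁ (Sn-app-inert cons Sn-cons sa) sb

RedList-cons-cell : (σ : Ty) {a b : Term n m} → Sn a → Red σ a → RedList (Red σ) b →
  RedList (Red σ) (app (app cons a) b)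
RedList-cons-cell σ sa ra rb =
  redList (Sn-cons-cell sa (Red⇒Sn (list σ) rb)) (reducts sa ra rb) (λ { refl → ra , rb })
  where
  reducts : ∀ {a b u} → Sn a → Red σ a → RedList (Red σ) b → app (app cons a) b ⟶ u → RedList (Red σ) u
  reducts (sn h _) ra rb               (ξ-appₗ (ξ-appᵣ st))     = RedList-cons-cell σ (h st) (Red-⟶ σ ra st) rb
  reducts sa       ra rb               (ξ-appₗ (root (throwᵣ _))) =
    Red-throwHeaded (list σ) (Sn-app-inert (thrown throw) sa (Red⇒Sn (list σ) rb)) (app throw)
  reducts sa       ra (redList _ h _) (ξ-appᵣ st)              = RedList-cons-cell σ sa ra (h st)
  reducts sa       ra rb               (root (throwᵣ _))        = Red-throwHeaded (list σ) (Red⇒Sn (list σ) rb) throw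
  reducts sa       ra rb               (ξ-appₗ (ξ-appₗ (root ())))

Red-cons : (σ : Ty) → Red {n} {m} (σ ⇒ list σ ⇒ list σ) cons
Red-cons σ = Sn-cons , λ θ a ra → Sn-app-inert cons Sn-cons (Red⇒Sn σ ra) ,
  λ θ' b rb → RedList-cons-cell σ (Red⇒Sn σ (Red-cren σ θ' ra)) (Red-cren σ θ' ra) rb

lrecStep : Ty → Ty → Ty
lrecStep ρ σ = σ ⇒ list σ ⇒ ρ ⇒ ρ

Red-lrec-app : (ρ σ : Ty) {r s l : Term n m} → Sn r → Sn s →
  Red ρ r → Red (lrecStep ρ σ) s → RedList (Red σ) l → Red ρ (app (app (app lrec r) s) l)
Red-lrec-app ρ σ snr sns rr rs rl =
  Red-neutral ρ (λ ()) (app (Sn-app-inert lrec₁ (Sn-app-inert lrec Sn-lrec snr) sns) (Red⇒Sn (list σ) rl))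
    (reducts snr sns rr rs rl)
  where
  reducts : ∀ {r s l u} → Sn r → Sn s → Red ρ r → Red (lrecStep ρ σ) s → RedList (Red σ) l →
    app (app (app lrec r) s) l ⟶ u → Red ρ u
  reducts (sn h _) sns rr rs rl (ξ-appₗ (ξ-appₗ (ξ-appᵣ st))) = Red-lrec-app ρ σ (h st) sns (Red-⟶ ρ rr st) rs rl
  reducts snr sns rr rs rl (ξ-appₗ (ξ-appₗ (root (throwᵣ _)))) =
    Red-throwHeaded ρ (Sn-app-inert (thrown (app throw)) (Sn-app-inert (thrown throw) snr sns) (Red⇒Sn (list σ) rl))
      (app (app throw))
  reducts snr (sn h _) rr rs rl (ξ-appₗ (ξ-appᵣ st)) = Red-lrec-app ρ σ snr (h st) rr (Red-⟶ (lrecStep ρ σ) rs st) rl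
  reducts snr sns rr rs rl (ξ-appₗ (root (throwᵣ _))) =
    Red-throwHeaded ρ (Sn-app-inert (thrown throw) sns (Red⇒Sn (list σ) rl)) (app throw)
  reducts snr sns rr rs (redList _ h _) (ξ-appᵣ st) = Red-lrec-app ρ σ snr sns rr rs (h st)
  reducts snr sns rr rs rl (root (throwᵣ _)) = Red-throwHeaded ρ (Red⇒Sn (list σ) rl) throw
  reducts snr sns rr rs rl (root (lrec-nil _ _)) = rr
  reducts snr sns rr rs (redList _ _ cell) (root (lrec-cons _ _ _ _)) with cell refl
  ... | rh , rt = Red-app {σ = ρ} (Red-app {σ = list σ} (Red-app {σ = σ} rs rh) rt) (Red-lrec-app ρ σ snr sns rr rs rt)
  reducts snr sns rr rs rl (ξ-appₗ (ξ-appₗ (ξ-appₗ (root ()))))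

Red-lrec : (ρ σ : Ty) → Red {n} {m} (ρ ⇒ lrecStep ρ σ ⇒ list σ ⇒ ρ) lrec
Red-lrec ρ σ = Sn-lrec , λ θ r rr → Sn-app-inert lrec Sn-lrec (Red⇒Sn ρ rr) ,
  λ θ' s rs → Sn-app-inert lrec₁ (Sn-app-inert lrec Sn-lrec (Red⇒Sn ρ (Red-cren ρ θ' rr))) (Red⇒Sn (lrecStep ρ σ) rs) ,
  λ θ'' l rl → let rr' = Red-cren ρ θ'' (Red-cren ρ θ' rr) ; rs' = Red-cren (lrecStep ρ σ) θ'' rs in
    Red-lrec-app ρ σ (Red⇒Sn ρ rr') (Red⇒Sn (lrecStep ρ σ) rs') rr' rs' rl

mutual
  Red-arrowFree : {ψ : Ty} → ArrowFree ψ → {t : Term n m} → Sn t → Red ψ t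
  Red-arrowFree unit      s = s
  Red-arrowFree (list af) s = RedList-arrowFree af s

  RedList-arrowFree : {ψ : Ty} → ArrowFree ψ → {t : Term n m} → Sn t → RedList (Red ψ) t
  RedList-arrowFree {ψ = ψ} af (sn h sub) = redList (sn h sub) (λ st → RedList-arrowFree af (h st)) (cell sub)
    where
    cell : ∀ {t a b} → SnSub t → t ≡ app (app cons a) b → Red ψ a × RedList (Red ψ) b
    cell (app (sn _ (app _ sa)) sb) refl = Red-arrowFree af sa , RedList-arrowFree af sb

-- The fundamental lemma

RedSubst : Ctx n → (Fin n → Term n' m) → Set
RedSubst Γ σ = ∀ i → Red (lookup Γ i) (σ i)

RedSubst-cren : (Γ : Ctx n) (θ : Fin m → Fin m') {σ : Fin n → Term n' m} → RedSubst Γ σ → RedSubst Γ (cren θ ∘ σ)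
RedSubst-cren Γ θ rσ i = Red-cren (lookup Γ i) θ (rσ i)

RedSubst-extend : {Γ : Ctx n} {σ : Fin n → Term n' m} {ρ : Ty} {v : Term n' m} →
  RedSubst Γ σ → Red ρ v → RedSubst (ρ ∷ Γ) (extend σ v)
RedSubst-extend rσ r zero    = r
RedSubst-extend rσ r (suc i) = rσ i

lam-body-instance : (θ : Fin m → Fin m') (θ' : Fin m' → Fin m'') (σ : Fin n → Term n' m')
  (b : Term (suc n) m) (v : Term n' m'') →
  cren θ' (subst (exts σ) (cren θ b)) [0:= v ] ≡ subst (extend (cren θ' ∘ σ) v) (cren (θ' ∘ θ) b)
lam-body-instance θ θ' σ b v = begin
  cren θ' (subst (exts σ) (cren θ b)) [0:= v ]
    ≡⟨ cong (_[0:= v ]) (cren-subst (cren-exts (λ _ → refl)) (cren θ b)) ⟩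
  subst (exts (cren θ' ∘ σ)) (cren θ' (cren θ b)) [0:= v ]
    ≡⟨ cong (λ z → subst (exts (cren θ' ∘ σ)) z [0:= v ]) (cren-∘ (λ _ → refl) b) ⟩
  subst (exts (cren θ' ∘ σ)) (cren (θ' ∘ θ) b) [0:= v ]
    ≡⟨ exts-[0:=] (cren θ' ∘ σ) v (cren (θ' ∘ θ) b) ⟩
  subst (extend (cren θ' ∘ σ) v) (cren (θ' ∘ θ) b) ∎
  where open ≡-Reasoning

fundamental : {Γ : Ctx n} {Δ : Ctx m} {t : Term n m} {ρ : Ty} → Γ ⨾ Δ ⊢ t ∶ ρ →
  (θ : Fin m → Fin m') (σ : Fin n → Term n' m') → ValueSubst σ → RedSubst Γ σ → Red ρ (subst σ (cren θ t))
fundamental (⊢var x)         θ σ vσ rσ = rσ x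
fundamental ⊢unit            θ σ vσ rσ = Sn-⟨⟩
fundamental (⊢nil {σ₀})      θ σ vσ rσ = Red-nil σ₀
fundamental (⊢cons {σ₀})     θ σ vσ rσ = Red-cons σ₀
fundamental (⊢lrec {ρ} {σ₀}) θ σ vσ rσ = Red-lrec ρ σ₀
fundamental {Γ = Γ} (⊢lam {σ₀} {τ} {b} d) θ σ vσ rσ = Red-lam σ₀ τ λ θ' v p r →
  transport (Red τ) (sym (lam-body-instance θ θ' σ b v))
    (fundamental d (θ' ∘ θ) (extend (cren θ' ∘ σ) v)
      (ValueSubst-extend (ValueSubst-cren θ' vσ) p) (RedSubst-extend (RedSubst-cren Γ θ' rσ) r))
fundamental (⊢app d e)       θ σ vσ rσ = Red-app (fundamental d θ σ vσ rσ) (fundamental e θ σ vσ rσ)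
fundamental {Γ = Γ} (⊢catch {ψ} af d) θ σ vσ rσ = Red-arrowFree af (Sn-catch (Red⇒Sn ψ
  (fundamental d (ext θ) (cren suc ∘ σ) (ValueSubst-cren suc vσ) (RedSubst-cren Γ suc rσ))))
fundamental {Δ = Δ} (⊢throw {α} {τ = τ} d) θ σ vσ rσ =
  Red-throwHeaded τ (Sn-throw (Red⇒Sn (lookup Δ α) (fundamental d θ σ vσ rσ))) throw

Sn-typed : {Γ : Ctx n} {Δ : Ctx m} {t : Term n m} {ρ : Ty} → Γ ⨾ Δ ⊢ t ∶ ρ → Sn t
Sn-typed {Γ = Γ} {t = t} {ρ} d =
  transport Sn (trans (subst-id (λ _ → refl) (cren id t)) (cren-id (λ _ → refl) t))
    (Red⇒Sn ρ (fundamental d id var var (λ i → Red-var (lookup Γ i) i)))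

-- Finite branching

value? : (t : Term n m) → Dec (Value t)
value? (var x)              = yes (var x)
value? ⟨⟩                   = yes ⟨⟩
value? nil                  = yes nil
value? cons                 = yes cons₀
value? lrec                 = yes lrec₀
value? (lam r)              = yes (lam r)
value? (catch t)            = no λ ()
value? (throw α t)          = no λ ()
value? (app cons v)         = map′ cons₁ (λ { (cons₁ p) → p }) (value? v)
value? (app lrec v)         = map′ lrec₁ (λ { (lrec₁ p) → p }) (value? v)
value? (app (app cons v) w) = map′ (uncurry cons₂) (λ { (cons₂ p q) → p , q }) (value? v ×-dec value? w)
value? (app (app lrec v) w) = map′ (uncurry lrec₂) (λ { (lrec₂ p q) → p , q }) (value? v ×-dec value? w)
value? (app (var x) _)      = no λ ()
value? (app ⟨⟩ _)           = no λ ()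
value? (app nil _)          = no λ ()
value? (app (lam r) _)      = no λ ()
value? (app (catch t) _)    = no λ ()
value? (app (throw α t) _)  = no λ ()
value? (app (app (var x) _) _)     = no λ ()
value? (app (app ⟨⟩ _) _)          = no λ ()
value? (app (app nil _) _)         = no λ ()
value? (app (app (lam r) _) _)     = no λ ()
value? (app (app (app _ _) _) _)   = no λ ()
value? (app (app (catch t) _) _)   = no λ ()
value? (app (app (throw α t) _) _) = no λ ()

CrenImage : (Fin m → Fin m') → Term n m' → Set
CrenImage ρ w = ∃ λ v → w ≡ cren ρ v

cren-image? : (ρ : Fin m → Fin m') (w : Term n m') → Dec (CrenImage ρ w)
cren-image? ρ (var x) = yes (var x , refl)
cren-image? ρ ⟨⟩      = yes (⟨⟩ , refl)
cren-image? ρ nil     = yes (nil , refl)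
cren-image? ρ cons    = yes (cons , refl)
cren-image? ρ lrec    = yes (lrec , refl)
cren-image? ρ (lam w) =
  map′ (λ (v , e) → lam v , cong lam e) (λ { (lam v , refl) → v , refl }) (cren-image? ρ w)
cren-image? ρ (app w₁ w₂) =
  map′ (λ ((v₁ , e₁) , (v₂ , e₂)) → app v₁ v₂ , cong₂ app e₁ e₂)
       (λ { (app v₁ v₂ , refl) → (v₁ , refl) , (v₂ , refl) })
       (cren-image? ρ w₁ ×-dec cren-image? ρ w₂)
cren-image? ρ (catch w) =
  map′ (λ (v , e) → catch v , cong catch e) (λ { (catch v , refl) → v , refl }) (cren-image? (ext ρ) w)
cren-image? ρ (throw α w) =
  map′ (λ ((γ , e₁) , (v , e₂)) → throw γ v , cong₂ throw e₁ e₂)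
       (λ { (throw γ v , refl) → (γ , refl) , (v , refl) })
       (any? (λ γ → α ≟ ρ γ) ×-dec cren-image? ρ w)

WeakenedValue : Term n (suc m) → Set
WeakenedValue w = ∃ λ v → Value v × w ≡ cren suc v

weakenedValue? : (w : Term n (suc m)) → Dec (WeakenedValue w)
weakenedValue? w with cren-image? suc w
... | no ¬img = no λ (v , _ , e) → ¬img (v , e)
... | yes (v , e) = map′ (λ p → v , p , e) value-of-image (value? v)
  where
  value-of-image : WeakenedValue w → Value v
  value-of-image (v' , p , e') = transport Value (cren-injective suc-injective (trans (sym e') e)) p

onlyIf : {A B : Set} → Dec A → (A → B) → List B
onlyIf (yes a) f = [ f a ]
onlyIf (no _)  f = []

Any-onlyIf : {A B : Set} {P : B → Set} (d : Dec A) {f : A → B} → A → (∀ a → P (f a)) → Any P (onlyIf d f)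
Any-onlyIf (yes a) _ h = here (h a)
Any-onlyIf (no ¬a) a _ = ⊥-elim (¬a a)

_∈ᵣ_ : {P : Term n m → Set} → Term n m → List (∃ P) → Set
u ∈ᵣ rs = Any ((u ≡_) ∘ proj₁) rs

module RootReducts where

  β-reduct : (a b : Term n m) → List (∃ (app a b ↦_))
  β-reduct (lam r) v = onlyIf (value? v) λ p → r [0:= v ] , β p
  β-reduct _       _ = []

  throwₗ-reduct : (a b : Term n m) → List (∃ (app a b ↦_))
  throwₗ-reduct (throw α t) s = [ throw α t , throwₗ ]
  throwₗ-reduct _           _ = []

  throwᵣ-reduct : (a b : Term n m) → List (∃ (app a b ↦_))
  throwᵣ-reduct v (throw α t) = onlyIf (value? v) λ p → throw α t , throwᵣ p
  throwᵣ-reduct _ _           = []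

  lrec-reduct : (a b : Term n m) → List (∃ (app a b ↦_))
  lrec-reduct (app (app lrec r) s) nil =
    onlyIf (value? r ×-dec value? s) λ (p , q) → r , lrec-nil p q
  lrec-reduct (app (app lrec r) s) (app (app cons h) l) =
    onlyIf ((value? r ×-dec value? s) ×-dec (value? h ×-dec value? l)) λ ((p , q) , (p' , q')) →
      app (app (app s h) l) (app (app (app lrec r) s) l) , lrec-cons p q p' q'
  lrec-reduct _ _ = []

  throwₜ-reduct : (α : Fin m) (t : Term n m) → List (∃ (throw α t ↦_))
  throwₜ-reduct γ (throw α t) = [ throw α t , throwₜ ]
  throwₜ-reduct _ _           = []

  catch-same-reduct : (w : Term n (suc m)) → List (∃ (catch w ↦_))
  catch-same-reduct (throw zero t) = [ catch t , catch-throw-same ]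
  catch-same-reduct _              = []

  catch-other-reduct : (w : Term n (suc m)) → List (∃ (catch w ↦_))
  catch-other-reduct (throw (suc γ) w) = onlyIf (weakenedValue? w) λ (v , p , e) →
    throw γ v , transport (λ z → catch (throw (suc γ) z) ↦ throw γ v) (sym e) (catch-throw-other p)
  catch-other-reduct _ = []

  catch-val-reduct : (w : Term n (suc m)) → List (∃ (catch w ↦_))
  catch-val-reduct w = onlyIf (weakenedValue? w) λ (v , p , e) →
    v , transport (λ z → catch z ↦ v) (sym e) (catch-val p)

  rootReducts : (t : Term n m) → List (∃ (t ↦_))
  rootReducts (app a b)   = β-reduct a b ++ throwₗ-reduct a b ++ throwᵣ-reduct a b ++ lrec-reduct a b
  rootReducts (throw α t) = throwₜ-reduct α t
  rootReducts (catch w)   = catch-same-reduct w ++ catch-other-reduct w ++ catch-val-reduct w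
  rootReducts _           = []

  weakening-unique : {v : Term n m} {w : Term n (suc m)} → w ≡ cren suc v →
    (x : WeakenedValue w) → v ≡ proj₁ x
  weakening-unique refl (_ , _ , e) = cren-injective suc-injective e

  rootReducts-complete : {t u : Term n m} → t ↦ u → u ∈ᵣ rootReducts t
  rootReducts-complete (β {v = v} p) = ++⁺ˡ (Any-onlyIf (value? v) p λ _ → refl)
  rootReducts-complete throwₗ = here refl
  rootReducts-complete {t = app a b} (throwᵣ p) =
    ++⁺ʳ (β-reduct a b) (++⁺ʳ (throwₗ-reduct a b) (++⁺ˡ (Any-onlyIf (value? a) p λ _ → refl)))
  rootReducts-complete {t = app a b} (lrec-nil p q) =
    ++⁺ʳ (β-reduct a b) (++⁺ʳ (throwₗ-reduct a b) (++⁺ʳ (throwᵣ-reduct a b)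
      (Any-onlyIf (value? _ ×-dec value? _) (p , q) λ _ → refl)))
  rootReducts-complete {t = app a b} (lrec-cons p q p' q') =
    ++⁺ʳ (β-reduct a b) (++⁺ʳ (throwₗ-reduct a b) (++⁺ʳ (throwᵣ-reduct a b)
      (Any-onlyIf ((value? _ ×-dec value? _) ×-dec (value? _ ×-dec value? _)) ((p , q) , (p' , q')) λ _ → refl)))
  rootReducts-complete throwₜ = here refl
  rootReducts-complete catch-throw-same = here refl
  rootReducts-complete {t = catch w} (catch-throw-other {γ} {v} p) =
    ++⁺ʳ (catch-same-reduct w) (++⁺ˡ (Any-onlyIf (weakenedValue? _) (v , p , refl)
      (cong (throw γ) ∘ weakening-unique refl)))
  rootReducts-complete {t = catch w} (catch-val {v} p) =
    ++⁺ʳ (catch-same-reduct w) (++⁺ʳ (catch-other-reduct w) (Any-onlyIf (weakenedValue? w) (v , p , refl)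
      (weakening-unique refl)))

open RootReducts using (rootReducts; rootReducts-complete)

rootSteps : (t : Term n m) → List (∃ (t ⟶_))
rootSteps t = map (Product.map₂ root) (rootReducts t)

mutual
  reducts : (t : Term n m) → List (∃ (t ⟶_))
  reducts t = rootSteps t ++ congReducts t

  congReducts : (t : Term n m) → List (∃ (t ⟶_))
  congReducts (lam b)     = map (Product.map lam ξ-lam) (reducts b)
  congReducts (app a b)   = map (Product.map (λ a' → app a' b) ξ-appₗ) (reducts a) ++
                            map (Product.map (app a) ξ-appᵣ) (reducts b)
  congReducts (catch b)   = map (Product.map catch ξ-catch) (reducts b)
  congReducts (throw α b) = map (Product.map (throw α) ξ-throw) (reducts b)
  congReducts _           = []

reducts-complete : {t u : Term n m} → t ⟶ u → u ∈ᵣ reducts t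
reducts-complete (root r) = ++⁺ˡ (map⁺ (rootReducts-complete r))
reducts-complete {t = lam b} (ξ-lam st) =
  ++⁺ʳ (rootSteps (lam b)) (gmap (cong lam) (reducts-complete st))
reducts-complete {t = app a b} (ξ-appₗ st) =
  ++⁺ʳ (rootSteps (app a b)) (++⁺ˡ (gmap (cong (λ a' → app a' b)) (reducts-complete st)))
reducts-complete {t = app a b} (ξ-appᵣ st) =
  ++⁺ʳ (rootSteps (app a b))
    (++⁺ʳ (map (Product.map (λ a' → app a' b) ξ-appₗ) (reducts a)) (gmap (cong (app a)) (reducts-complete st)))
reducts-complete {t = catch b} (ξ-catch st) =
  ++⁺ʳ (rootSteps (catch b)) (gmap (cong catch) (reducts-complete st))
reducts-complete {t = throw α b} (ξ-throw st) =
  ++⁺ʳ (rootSteps (throw α b)) (gmap (cong (throw α)) (reducts-complete st))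

BoundedBy : ℕ → Term n m → Set
BoundedBy b t = ∀ k s → t ⟶[ k ] s → k ≤ b

BoundedBy-mono : {b b' : ℕ} {t : Term n m} → b ≤ b' → BoundedBy b t → BoundedBy b' t
BoundedBy-mono le bd k s seq = ≤-trans (bd k s seq) le

BoundedBy-suc : {b : ℕ} {t : Term n m} → (∀ {u} → t ⟶ u → BoundedBy b u) → BoundedBy (suc b) t
BoundedBy-suc bd zero    s done            = z≤n
BoundedBy-suc bd (suc k) s (step st steps) = s≤s (bd st k s steps)

uniformBound : {A : Set} (f : A → Term n m) (xs : List A) → All (SN ∘ f) xs → ∃ λ b → All (BoundedBy b ∘ f) xs
uniformBound f []       []              = 0 , []
uniformBound f (x ∷ xs) ((b , bd) ∷ bds) with uniformBound f xs bds
... | b' , bds' = b ⊔ b' , BoundedBy-mono (m≤m⊔n b b') bd ∷ All.map (BoundedBy-mono (m≤n⊔m b b')) bds'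

-- König's lemma for the finitely branching reduction relation.
Sn⇒SN : {t : Term n m} → Sn t → SN t
Sn⇒SN {t = t} (sn h _) with uniformBound proj₁ (reducts t) (All.tabulate λ {e} _ → Sn⇒SN (h (proj₂ e)))
... | b , bds = suc b , BoundedBy-suc λ st →
  All.lookupWith (λ bd eq → transport (BoundedBy b) (sym eq) bd) bds (reducts-complete st)

theorem4p18 : ∀ {n m} (Γ : Ctx n) (Δ : Ctx m) (t : Term n m) (ρ : Ty) →
    ArrowFreeCtx Δ → Γ ⨾ Δ ⊢ t ∶ ρ → SN t
theorem4p18 Γ Δ t ρ _ ⊢t = Sn⇒SN (Sn-typed ⊢t)
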